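{- For any image-finite pointed partial epistemic models $(\mathcal M,s)$ and $(\mathcal M',s')$, \[ (\mathcal M,s)\mathrel{\underline{\leftrightarrow}}(\mathcal M',s') \quad\Longleftrightarrow\quad (\mathcal M,s)\equiv^{\mathsf{par}}(\mathcal M',s'). \]
   Context: Let $A$ be a finite set of agents and $P_a$ ($a\in A$) mutually disjoint countable sets of local atoms; $\mathcal L^+$ is $\varphi ::= a \mid p_a \mid \neg\varphi \mid (\varphi\wedge\varphi)\mid \widehat K_a\varphi$. A partial epistemic model $\mathcal M=(S,\sim,L)$ has a set of states $S$, for each agent $a$ a partial equivalence relation $\sim_a$ (an equivalence relation on the set $S_a$ of states where $a$ is alive), such that the relations are proper (for distinct $s,t$ some $b$ alive in $s$ has $s\not\sim_b t$), and a valuation $L\colon S\to 2^{A\cup\bigcup_a P_a}$ with $p_a\in L(s)\iff p_a\in L(t)$ whenever $s\sim_a t$, and $a\in L(u)$ iff $u\in S_a$; $A_s$ denotes agents alive in $s$. It is image-finite iff each equivalence class $[s]_a$ is finite. Three-valued semantics: $a$ is always defined and true at $s$ iff $s\in S_a$; $p_a$ is defined at $s$ iff $s\in S_a$ and true iff moreover $p_a\in L(s)$; $\neg\varphi$ is defined iff $\varphi$ is, and true iff $\varphi$ is defined and not true; $\varphi\wedge\psi$ is defined iff both are, true iff both true; $\widehat K_a\varphi$ is defined (true) at $s$ iff $\varphi$ is defined (true) at some $t\sim_a s$. $(\mathcal M,s)\equiv^{\mathsf{par}}(\mathcal M',s')$ means every $\varphi\in\mathcal L^+$ is defined, true, and has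 true negation at $s$ iff the same holds at $s'$. $(\mathcal M,s)\mathrel{\underline{\leftrightarrow}}(\mathcal M',s')$ means there is a life bisimulation ${\mathcal Z}$ with $s{\mathcal Z}s'$: a nonempty ${\mathcal Z}\subseteq S\times S'$ such that whenever $u{\mathcal Z}u'$: $L(u)\cap A=L'(u')\cap A$ and $L(u)\cap P_a=L'(u')\cap P_a$ for each $a\in A_u$; for all $a\in A_u$ and $t\sim_a u$ there is $t'\sim'_a u'$ with $t{\mathcal Z}t'$; and for all $a\in A_{u'}$ and $t'\sim'_a u'$ there is $t\sim_a u$ with $t{\mathcal Z}t'$. -}

module Defs where

open import Level using (0ℓ)
open import Data.Nat using (ℕ)
open import Data.Fin using (Fin)
open import Data.Unit using (⊤)
open import Data.Empty using (⊥)
open import Data.Product using (Σ; ∃; ∃-syntax; _×_; _,_)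
open import Data.Sum using (_⊎_; inj₁; inj₂)
open import Data.List using (List)
open import Data.List.Membership.Propositional using (_∈_)
open import Relation.Nullary using (¬_)
open import Relation.Binary.PropositionalEquality using (_≡_; _≢_)
open import Function.Bundles using (_⇔_)
open import Function.Definitions using (Injective)

-- Agents: the finite set A is Fin n.
-- Local atoms: P a for each agent a; disjointness is built in by tagging
-- atoms with their agent (Σ (Fin n) P).  Countability is an explicit hypothesis.
Countable : Set → Set
Countable X = Σ (X → ℕ) (Injective _≡_ _≡_)

module _ {n : ℕ} (P : Fin n → Set) where

  Atom : Set
  Atom = Fin n ⊎ Σ (Fin n) P

  -- Formulas of L⁺ (◇ a φ stands for K̂_a φ).
  data Form : Set where
    ag  : Fin n → Form
    at  : (a : Fin n) → P a → Form
    ¬'_ : Form → Form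
    _∧'_ : Form → Form → Form
    ◇ : Fin n → Form → Form

  record PEM : Set₁ where
    field
      S : Set
      R : Fin n → S → S → Set
      L : S → Atom → Set

    -- S_a: states where a is alive; by definition a ∈ L(u) iff u ∈ S_a.
    Alive : Fin n → S → Set
    Alive a s = L s (inj₁ a)

    field
      R-dom   : ∀ a s t → R a s t → Alive a s × Alive a t
      R-refl  : ∀ a s → Alive a s → R a s s
      R-sym   : ∀ a s t → R a s t → R a t s
      R-trans : ∀ a s t u → R a s t → R a t u → R a s u
      proper  : ∀ s t → s ≢ t → ∃[ b ] (Alive b s × ¬ R b s t)
      local   : ∀ a (p : P a) s t → R a s t →
                (L s (inj₂ (a , p)) ⇔ L t (inj₂ (a , p)))

  open PEM

  ImageFinite : PEM → Set
  ImageFinite M = ∀ a s → ∃[ xs ] (∀ t → R M a s t → t ∈ xs)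

  Def : (M : PEM) → Form → S M → Set
  Def M (ag a) s = ⊤
  Def M (at a p) s = Alive M a s
  Def M (¬' φ) s = Def M φ s
  Def M (φ ∧' ψ) s = Def M φ s × Def M ψ s
  Def M (◇ a φ) s = ∃[ t ] (R M a s t × Def M φ t)

  Tru : (M : PEM) → Form → S M → Set
  Tru M (ag a) s = Alive M a s
  Tru M (at a p) s = Alive M a s × L M s (inj₂ (a , p))
  Tru M (¬' φ) s = Def M φ s × ¬ Tru M φ s
  Tru M (φ ∧' ψ) s = Tru M φ s × Tru M ψ s
  Tru M (◇ a φ) s = ∃[ t ] (R M a s t × Tru M φ t)

  EquivPar : (M : PEM) → S M → (M' : PEM) → S M' → Set
  EquivPar M s M' s' = ∀ φ →
    (Def M φ s ⇔ Def M' φ s') ×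
    (Tru M φ s ⇔ Tru M' φ s') ×
    (Tru M (¬' φ) s ⇔ Tru M' (¬' φ) s')

  record IsLifeBisim (M M' : PEM) (Z : S M → S M' → Set) : Set where
    field
      nonempty : ∃[ u ] ∃[ u' ] Z u u'
      agents   : ∀ {u u'} → Z u u' → ∀ a → (L M u (inj₁ a) ⇔ L M' u' (inj₁ a))
      locals   : ∀ {u u'} → Z u u' → ∀ a → Alive M a u →
                 ∀ (p : P a) → (L M u (inj₂ (a , p)) ⇔ L M' u' (inj₂ (a , p)))
      forth    : ∀ {u u'} → Z u u' → ∀ a → Alive M a u →
                 ∀ t → R M a u t → ∃[ t' ] (R M' a u' t' × Z t t')
      back     : ∀ {u u'} → Z u u' → ∀ a → Alive M' a u' →
                 ∀ t' → R M' a u' t' → ∃[ t ] (R M a u t × Z t t')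

  LifeBisimilar : (M : PEM) → S M → (M' : PEM) → S M' → Set₁
  LifeBisimilar M s M' s' =
    Σ (S M → S M' → Set) λ Z → IsLifeBisim M M' Z × Z s s'

{-# OPTIONS --safe #-}
-- Life bisimulations preserve definedness and truth by induction on formulas.
-- Conversely, truth-equivalence is a life bisimulation: if a successor t of u had
-- no truth-equivalent successor of u', each of the finitely many successors of u'
-- is separated from t by a formula true at t, and ◇ of their conjunction separates
-- u from u'.  The delicate case of separation is a formula undefined at t but
-- defined at t'; by induction it yields a formula true at t and false at t', where
-- for ◇ a χ the successors of t are excluded one at a time while keeping the
-- formula defined at some successor.
module Submission where

open import Defs
open import Data.Nat using (ℕ)
open import Data.Fin using (Fin)
open import Level using (0ℓ)
open import Axiom.ExcludedMiddle using (ExcludedMiddle)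
open import Function.Bundles using (_⇔_; mk⇔; module Equivalence)

open import Function.Base using (const; _∘_)
open import Function.Properties.Equivalence using () renaming (sym to ⇔-sym)
open import Function.Related.TypeIsomorphisms using (¬-cong-⇔)
open import Data.Unit using (tt)
open import Data.Empty using (⊥-elim)
open import Data.Product using (∃-syntax; _×_; _,_; proj₁; proj₂; zip)
open import Data.Product.Function.NonDependent.Propositional using (_×-⇔_)
open import Data.Sum using (_⊎_; inj₁; inj₂)
open import Data.List using (List; []; _∷_)
open import Data.List.Membership.Propositional using (_∈_)
open import Data.List.Relation.Unary.Any using (here; there; tail)
open import Data.List.Relation.Unary.Any.Properties using (¬Any[])
open import Relation.Nullary using (¬_; yes; no)
open import Relation.Nullary.Decidable using (decidable-stable)
open import Relation.Binary.PropositionalEquality using (refl)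

open Equivalence using (to; from)

module _ {n : ℕ} {P : Fin n → Set} where
  open PEM

  Tru⇒Def : {M : PEM P} (φ : Form P) {s : S M} → Tru P M φ s → Def P M φ s
  Tru⇒Def (ag a) _ = tt
  Tru⇒Def (at a p) (alive , _) = alive
  Tru⇒Def (¬' φ) (φ↓ , _) = φ↓
  Tru⇒Def (φ ∧' ψ) (φt , ψt) = Tru⇒Def φ φt , Tru⇒Def ψ ψt
  Tru⇒Def (◇ a φ) (t , st , φt) = t , st , Tru⇒Def φ φt

  ¬'-cong : {M N : PEM P} (φ : Form P) {s : S M} {s' : S N} →
            Def P M φ s ⇔ Def P N φ s' → Tru P M φ s ⇔ Tru P N φ s' →
            Tru P M (¬' φ) s ⇔ Tru P N (¬' φ) s'
  ¬'-cong _ φ↓ φ⊤ = φ↓ ×-⇔ ¬-cong-⇔ φ⊤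

  module _ {M N : PEM P} {Z : S M → S N → Set} (B : IsLifeBisim P M N Z) where
    open IsLifeBisim B

    ◇-transfer : {X : S M → Set} {Y : S N → Set} →
                 (∀ {v v'} → Z v v' → X v ⇔ Y v') →
                 ∀ {u u'} → Z u u' → ∀ a →
                 (∃[ t ] (R M a u t × X t)) ⇔ (∃[ t' ] (R N a u' t' × Y t'))
    ◇-transfer X⇔Y {u} {u'} uZu' a = mk⇔ there→ ←there
      where
      there→ : ∃[ t ] (R M a u t × _) → ∃[ t' ] (R N a u' t' × _)
      there→ (t , ut , Xt) with forth uZu' a (proj₁ (R-dom M a u t ut)) t ut
      ... | t' , u't' , tZt' = t' , u't' , to (X⇔Y tZt') Xt
      ←there : ∃[ t' ] (R N a u' t' × _) → ∃[ t ] (R M a u t × _)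
      ←there (t' , u't' , Yt') with back uZu' a (proj₁ (R-dom N a u' t' u't')) t' u't'
      ... | t , ut , tZt' = t , ut , from (X⇔Y tZt') Yt'

    bisim-preserves : ∀ {u u'} → Z u u' → ∀ φ →
                      (Def P M φ u ⇔ Def P N φ u') × (Tru P M φ u ⇔ Tru P N φ u')
    bisim-preserves uZu' (ag a) = mk⇔ (const tt) (const tt) , agents uZu' a
    bisim-preserves uZu' (at a p) =
      agents uZu' a ,
      mk⇔ (λ (alive , p∈) → to (agents uZu' a) alive , to (locals uZu' a alive p) p∈)
          (λ (alive' , p∈') → let alive = from (agents uZu' a) alive'
                              in alive , from (locals uZu' a alive p) p∈')
    bisim-preserves uZu' (¬' φ) =
      let φ↓ , φ⊤ = bisim-preserves uZu' φ in φ↓ , ¬'-cong φ φ↓ φ⊤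
    bisim-preserves uZu' (φ ∧' ψ) =
      zip _×-⇔_ _×-⇔_ (bisim-preserves uZu' φ) (bisim-preserves uZu' ψ)
    bisim-preserves uZu' (◇ a φ) =
      ◇-transfer (λ vZv' → proj₁ (bisim-preserves vZv' φ)) uZu' a ,
      ◇-transfer (λ vZv' → proj₂ (bisim-preserves vZv' φ)) uZu' a

  LifeBisimilar⇒EquivPar : {M N : PEM P} {s : S M} {s' : S N} →
                           LifeBisimilar P M s N s' → EquivPar P M s N s'
  LifeBisimilar⇒EquivPar (Z , B , sZs') φ =
    let φ↓ , φ⊤ = bisim-preserves B sZs' φ in φ↓ , φ⊤ , ¬'-cong φ φ↓ φ⊤

  TruEquiv : (M N : PEM P) → S M → S N → Set
  TruEquiv M N u u' = ∀ φ → Tru P M φ u ⇔ Tru P N φ u'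

  TruEquiv-sym : {M N : PEM P} {u : S M} {u' : S N} → TruEquiv M N u u' → TruEquiv N M u' u
  TruEquiv-sym u≈u' φ = ⇔-sym (u≈u' φ)

  Separable : (M N : PEM P) → S M → S N → Set
  Separable M N t t' = ∃[ θ ] (Tru P M θ t × ¬ Tru P N θ t')

  StrictlySeparable : (M N : PEM P) → S M → S N → Set
  StrictlySeparable M N t t' = ∃[ θ ] (Tru P M θ t × Tru P N (¬' θ) t')

  dead-vs-alive : {M N : PEM P} {t : S M} {t' : S N} {a : Fin n} →
                  ¬ Alive M a t → Alive N a t' → StrictlySeparable M N t t'
  dead-vs-alive {a = a} dead alive' = ¬' ag a , (tt , dead) , (tt , λ (_ , dead') → dead' alive')

  module _ (em : ExcludedMiddle 0ℓ) where

    ¬∀⇒∃¬ : {A : Set} {B : A → Set} → ¬ (∀ x → B x) → ∃[ x ] ¬ B x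
    ¬∀⇒∃¬ {B = B} ¬∀ with em {∃[ x ] ¬ B x}
    ... | yes ∃¬ = ∃¬
    ... | no ¬∃¬ = ⊥-elim (¬∀ λ x → decidable-stable em (λ ¬Bx → ¬∃¬ (x , ¬Bx)))

    ¬⇔⇒ : {A B : Set} → ¬ (A ⇔ B) → (A × ¬ B) ⊎ (B × ¬ A)
    ¬⇔⇒ {A} {B} ¬A⇔B with em {A} | em {B}
    ... | yes a | yes b = ⊥-elim (¬A⇔B (mk⇔ (const b) (const a)))
    ... | yes a | no ¬b = inj₁ (a , ¬b)
    ... | no ¬a | yes b = inj₂ (b , ¬a)
    ... | no ¬a | no ¬b = ⊥-elim (¬A⇔B (mk⇔ (⊥-elim ∘ ¬a) (⊥-elim ∘ ¬b)))

    module _ {M N : PEM P} where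

      uniform-separator : (X : S M → Set) {w' : S N} →
                          (∀ x → X x → StrictlySeparable M N x w') →
                          (xs : List (S M)) → (∀ x → X x → x ∈ xs) → ∀ {x₀} → X x₀ →
                          ∃[ Ψ ] (Tru P N Ψ w' × (∃[ x ] (X x × Def P M Ψ x)) ×
                                  (∀ x → X x → ¬ Tru P M Ψ x))
      uniform-separator X {w'} sep xs X⊆xs {x₀} Xx₀ =
        let θ , θx₀ , ¬θw' = sep x₀ Xx₀
        in exclude xs (¬' θ) ¬θw' (x₀ , Xx₀ , Tru⇒Def θ θx₀) (λ x Xx _ → X⊆xs x Xx)
        where
        exclude : (xs : List (S M)) (Ψ : Form P) → Tru P N Ψ w' → ∃[ x ] (X x × Def P M Ψ x) →
                  (∀ x → X x → Tru P M Ψ x → x ∈ xs) →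
                  ∃[ Ψ' ] (Tru P N Ψ' w' × (∃[ x ] (X x × Def P M Ψ' x)) ×
                           (∀ x → X x → ¬ Tru P M Ψ' x))
        exclude [] Ψ Ψw' Ψ↓ Ψ⊆[] = Ψ , Ψw' , Ψ↓ , λ x Xx Ψx → ¬Any[] (Ψ⊆[] x Xx Ψx)
        exclude (x ∷ xs) Ψ Ψw' Ψ↓ Ψ⊆x∷xs with em {X x × Tru P M Ψ x}
        ... | no ¬Ψx =
          exclude xs Ψ Ψw' Ψ↓ λ y Xy Ψy →
            tail (λ { refl → ¬Ψx (Xy , Ψy) }) (Ψ⊆x∷xs y Xy Ψy)
        -- ¬ θ is conjoined only where Ψ is true, hence defined, so Ψ ∧' ¬' θ stays
        -- defined somewhere on X.
        ... | yes (Xx , Ψx) =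
          let θ , θx , ¬θw' = sep x Xx
          in exclude xs (Ψ ∧' (¬' θ)) (Ψw' , ¬θw') (x , Xx , Tru⇒Def Ψ Ψx , Tru⇒Def θ θx)
               λ { y Xy (Ψy , (_ , ¬θy)) →
                     tail (λ { refl → ¬θy θx }) (Ψ⊆x∷xs y Xy Ψy) }

      undefined-vs-defined : ImageFinite P M → ∀ χ {t : S M} {t' : S N} →
                             ¬ Def P M χ t → Def P N χ t' → StrictlySeparable M N t t'
      undefined-vs-defined fin (ag a) χ↑ _ = ⊥-elim (χ↑ tt)
      undefined-vs-defined fin (at a p) χ↑ χ↓' = dead-vs-alive χ↑ χ↓'
      undefined-vs-defined fin (¬' χ) = undefined-vs-defined fin χ
      undefined-vs-defined fin (χ₁ ∧' χ₂) {t} χ↑ (χ₁↓' , χ₂↓') with em {Def P M χ₁ t}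
      ... | yes χ₁↓ = undefined-vs-defined fin χ₂ (λ χ₂↓ → χ↑ (χ₁↓ , χ₂↓)) χ₂↓'
      ... | no χ₁↑ = undefined-vs-defined fin χ₁ χ₁↑ χ₁↓'
      undefined-vs-defined fin (◇ a χ) {t} {t'} χ↑ (w' , t'w' , χw') with em {Alive M a t}
      ... | no dead = dead-vs-alive dead (proj₁ (R-dom N a t' w' t'w'))
      ... | yes alive =
        let xs , t⊆xs = fin a t
            Ψ , Ψw' , Ψ↓ , ¬Ψ = uniform-separator (R M a t)
              (λ x tx → undefined-vs-defined fin χ (λ χx → χ↑ (x , tx , χx)) χw')
              xs t⊆xs (R-refl M a t alive)
        in ¬' ◇ a Ψ ,
           (Ψ↓ , λ (x , tx , Ψx) → ¬Ψ x tx Ψx) ,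
           ((w' , t'w' , Tru⇒Def Ψ Ψw') , λ (_ , ¬◇Ψ) → ¬◇Ψ (w' , t'w' , Ψw'))

      ¬TruEquiv⇒Separable : ImageFinite P M → {t : S M} {t' : S N} →
                            ¬ TruEquiv M N t t' → Separable M N t t'
      ¬TruEquiv⇒Separable fin {t} t≢t' with ¬∀⇒∃¬ t≢t'
      ... | φ , φt≢φt' with ¬⇔⇒ φt≢φt'
      ... | inj₁ separates = φ , separates
      ... | inj₂ (φt' , ¬φt) with em {Def P M φ t}
      ... | yes φ↓ = ¬' φ , (φ↓ , ¬φt) , λ (_ , ¬φt'') → ¬φt'' φt'
      ... | no φ↑ =
        let θ , θt , (_ , ¬θt') = undefined-vs-defined fin φ φ↑ (Tru⇒Def φ φt')
        in θ , θt , ¬θt'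

      conjoin-separators : (Ψ₀ : Form P) {t : S M} → Tru P M Ψ₀ t →
                           (Y : S N → Set) → (∀ y → Y y → Separable M N t y) →
                           (ys : List (S N)) →
                           ∃[ Ψ ] (Tru P M Ψ t × (∀ y → y ∈ ys → Y y → ¬ Tru P N Ψ y))
      conjoin-separators Ψ₀ Ψ₀t Y sep [] = Ψ₀ , Ψ₀t , λ _ ()
      conjoin-separators Ψ₀ Ψ₀t Y sep (y ∷ ys)
        with conjoin-separators Ψ₀ Ψ₀t Y sep ys | em {Y y}
      ... | Ψ , Ψt , ¬Ψ | no ¬Yy =
        Ψ , Ψt , λ { _ (here refl) Yy → ⊥-elim (¬Yy Yy) ; z (there z∈ys) → ¬Ψ z z∈ys }
      ... | Ψ , Ψt , ¬Ψ | yes Yy =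
        let ψ , ψt , ¬ψy = sep y Yy
        in Ψ ∧' ψ , (Ψt , ψt) ,
           λ { _ (here refl) _ (_ , ψy) → ¬ψy ψy
             ; z (there z∈ys) Yz (Ψz , _) → ¬Ψ z z∈ys Yz Ψz }

      TruEquiv-forth : ImageFinite P M → ImageFinite P N →
                       ∀ {u u'} → TruEquiv M N u u' → ∀ a t → R M a u t →
                       ∃[ t' ] (R N a u' t' × TruEquiv M N t t')
      TruEquiv-forth finM finN {u} {u'} u≈u' a t ut
        with em {∃[ t' ] (R N a u' t' × TruEquiv M N t t')}
      ... | yes matched = matched
      ... | no unmatched =
        let ys , u'⊆ys = finN a u'
            Ψ , Ψt , ¬Ψ = conjoin-separators (ag a) (proj₂ (R-dom M a u t ut)) (R N a u')
              (λ y u'y → ¬TruEquiv⇒Separable finM (λ t≈y → unmatched (y , u'y , t≈y))) ys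
            y , u'y , Ψy = to (u≈u' (◇ a Ψ)) (t , ut , Ψt)
        in ⊥-elim (¬Ψ y (u'⊆ys y u'y) u'y Ψy)

    TruEquiv-isLifeBisim : {M N : PEM P} → ImageFinite P M → ImageFinite P N →
                           {s : S M} {s' : S N} → TruEquiv M N s s' →
                           IsLifeBisim P M N (TruEquiv M N)
    TruEquiv-isLifeBisim finM finN {s} {s'} s≈s' = record
      { nonempty = s , s' , s≈s'
      ; agents   = λ u≈u' a → u≈u' (ag a)
      ; locals   = λ u≈u' a alive p →
          mk⇔ (λ p∈ → proj₂ (to (u≈u' (at a p)) (alive , p∈)))
              (λ p∈' → proj₂ (from (u≈u' (at a p)) (to (u≈u' (ag a)) alive , p∈')))
      ; forth    = λ u≈u' a _ → TruEquiv-forth finM finN u≈u' a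
      ; back     = λ u≈u' a _ t' u't' →
          let t , ut , t'≈t = TruEquiv-forth finN finM (TruEquiv-sym u≈u') a t' u't'
          in t , ut , TruEquiv-sym t'≈t
      }

    EquivPar⇒LifeBisimilar : {M N : PEM P} → ImageFinite P M → ImageFinite P N →
                             {s : S M} {s' : S N} →
                             EquivPar P M s N s' → LifeBisimilar P M s N s'
    EquivPar⇒LifeBisimilar {M} {N} finM finN {s} {s'} s≈ₚs' =
      TruEquiv M N , TruEquiv-isLifeBisim finM finN s≈s' , s≈s'
      where
      s≈s' : TruEquiv M N s s'
      s≈s' φ = proj₁ (proj₂ (s≈ₚs' φ))

theorem5p10 : ExcludedMiddle 0ℓ →
    (n : ℕ) (P : Fin n → Set) → (∀ a → Countable (P a)) →
    (M M' : PEM P) → ImageFinite P M → ImageFinite P M' →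
    (s : PEM.S M) (s' : PEM.S M') →
    LifeBisimilar P M s M' s' ⇔ EquivPar P M s M' s'
theorem5p10 em n P _ M M' finM finM' s s' =
  mk⇔ LifeBisimilar⇒EquivPar (EquivPar⇒LifeBisimilar em finM finM')
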